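{- Let $n\ge5$ and let $G$ be the bipyramid graph on $[n]$. Assume that the ML degree of $G$ is given by $\mu(G)=\bigl|\sum_{s=3}^{n}(-1)^{s-3}(s-3)!\,\pi_G(s)\bigr|$. Then $\mu(G)=n-4$.
   Context: The bipyramid graph $G$ on $[n]$ ($n\ge5$) has the edges of the $(n-2)$-cycle $3,4,\dots,n,3$ together with the edges $1i$ and $2i$ for all $i\in\{3,\dots,n\}$. $\pi_G(s)$ is the number of partitions of the vertex set $[n]$ into $s$ nonempty blocks each of which is an independent set of $G$. The ML degree $\mu(G)$ is the number of critical points in $\mathcal M_{0,n}$ (moduli of $n$ distinct points of $\mathbb P^1$ modulo $\mathrm{PGL}(2)$), i.e. $\mathrm{PGL}(2)$-orbits of solutions with pairwise distinct coordinates, of $\sum_{j\in G_i}s_{ij}/(x_i-x_j)=0$ ($i=1,\dots,n$) for generic $s=(s_{ij})_{ij\in G}$ satisfying $\sum_{j\in G_i}s_{ij}=0$ for all $i$, where $G_i$ is the set of neighbours of $i$. -}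

module Defs where

open import Data.Nat using (ℕ; zero; suc; _+_; _*_; _∸_; _≡ᵇ_; _≤ᵇ_; _!)
open import Data.Bool using (Bool; true; false; _∧_; _∨_; not; if_then_else_)
open import Data.List using (List; []; _∷_; [_]; map; concatMap; upTo; length)
open import Data.Integer as ℤ using (ℤ; +_; -_; ∣_∣)

-- Vertices are labelled 1,…,n (as in the paper).

isCycleVertex : ℕ → ℕ → Bool
isCycleVertex n i = (3 ≤ᵇ i) ∧ (i ≤ᵇ n)

isApex : ℕ → Bool
isApex i = (i ≡ᵇ 1) ∨ (i ≡ᵇ 2)

cycleAdj : ℕ → ℕ → ℕ → Bool
cycleAdj n i j =
  isCycleVertex n i ∧ isCycleVertex n j ∧
  ((suc i ≡ᵇ j) ∨ (suc j ≡ᵇ i) ∨ ((i ≡ᵇ 3) ∧ (j ≡ᵇ n)) ∨ ((i ≡ᵇ n) ∧ (j ≡ᵇ 3)))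

bipyramidAdj : ℕ → ℕ → ℕ → Bool
bipyramidAdj n i j =
  cycleAdj n i j ∨ (isApex i ∧ isCycleVertex n j) ∨ (isApex j ∧ isCycleVertex n i)

vertexList : ℕ → List ℕ
vertexList n = map suc (upTo n)

-- All set partitions of the (duplicate-free) list: every block is nonempty,
-- each partition is listed exactly once.
insertEverywhere : {A : Set} → A → List (List A) → List (List (List A))
insertEverywhere x [] = []
insertEverywhere x (b ∷ bs) = ((x ∷ b) ∷ bs) ∷ map (b ∷_) (insertEverywhere x bs)

setPartitions : {A : Set} → List A → List (List (List A))
setPartitions [] = [] ∷ []
setPartitions (x ∷ xs) =
  concatMap (λ p → ([ x ] ∷ p) ∷ insertEverywhere x p) (setPartitions xs)

allB : {A : Set} → (A → Bool) → List A → Bool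
allB p [] = true
allB p (x ∷ xs) = p x ∧ allB p xs

independent : ℕ → List ℕ → Bool
independent n b = allB (λ i → allB (λ j → not (bipyramidAdj n i j)) b) b

count : {A : Set} → (A → Bool) → List A → ℕ
count p [] = 0
count p (x ∷ xs) = if p x then suc (count p xs) else count p xs

piG : ℕ → ℕ → ℕ
piG n s = count (λ P → (length P ≡ᵇ s) ∧ allB (independent n) P) (setPartitions (vertexList n))

signPow : ℕ → ℤ
signPow zero = + 1
signPow (suc k) = - signPow k

sumℤ : List ℤ → ℤ
sumℤ [] = + 0
sumℤ (x ∷ xs) = x ℤ.+ sumℤ xs

-- Σ_{s=3}^{n} (-1)^{s-3} (s-3)! π_G(s)   (s = 3 + k, k = 0,…,n-3)
alternatingSum : ℕ → ℤ
alternatingSum n =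
  sumℤ (map (λ k → signPow k ℤ.* ((+ (k !)) ℤ.* (+ piG n (3 + k)))) (upTo (n ∸ 2)))

{-# OPTIONS --safe #-}
module Submission where

-- The alternating sum equals the sum of φ 3 (number of blocks) over the partitions of [n] into
-- independent blocks, where φ 3 s = (-1)^(s-3) (s-3)!.  Such sums are computed by deleting one
-- vertex x at a time: a partition of x ∷ xs is a partition p of xs to which x is added either as
-- a singleton or inside a block of p containing no neighbour of x.  Deleting the apices 1 and 2,
-- which are adjacent to every cycle vertex, and then the cycle vertex 3, whose neighbours 4 and n
-- may or may not share a block, leaves sums over partitions of the path 4, …, n whose weights
-- depend on the number of blocks and on whether 4 and n share a block.  Deleting the first vertex
-- of a path acts on a weight g of the number of blocks by ∂ g t = g (t + 1) + (t - 1) g t, and the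
-- shifted signed factorials φ 1, φ 2 are (generalised) eigenfunctions of ∂; induction along the
-- path then evaluates everything, and the terms add up to (-1)^(n-5) (n-4).

open import Defs
open import Data.Nat using (ℕ; _≤_; _∸_)
open import Data.Integer using (∣_∣)
open import Relation.Binary.PropositionalEquality using (_≡_)

open import Data.Bool using (Bool; true; false; _∧_; _∨_; not; if_then_else_)
import Data.Bool.Properties as 𝔹ₚ
open import Data.Bool.Solver using (module ∨-∧-Solver)
open import Data.Integer using (ℤ; +_; -_; _+_; _-_; _*_)
import Data.Integer.Properties as ℤₚ
open import Data.Integer.Tactic.RingSolver using (solve-∀)
open import Data.List using (List; []; _∷_; [_]; map; concatMap; length; _++_; upTo; applyUpTo)
import Data.List.Properties as Listₚ
open import Data.List.Relation.Unary.All as All using (All; []; _∷_)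
import Data.List.Relation.Unary.All.Properties as Allₚ
open import Data.List.Relation.Unary.AllPairs using ([]; _∷_)
open import Data.List.Relation.Unary.Unique.Propositional using (Unique)
open import Data.Nat as ℕ using (zero; suc; _<_; z≤n; s≤s; _≡ᵇ_; _≤ᵇ_; _!)
import Data.Nat.Properties as ℕₚ
open import Data.Product using (_×_; _,_)
open import Data.Sum using (inj₁; inj₂)
open import Data.Unit using (tt)
open import Function using (_∘_; id)
open import Function.Bundles using (Equivalence)
open import Relation.Binary.PropositionalEquality
  using (refl; sym; trans; cong; cong₂; _≢_; module ≡-Reasoning)
open import Relation.Nullary using (contradiction; yes; no)

private
  variable
    A : Set

≡ᵇ-refl : ∀ k → (k ≡ᵇ k) ≡ true
≡ᵇ-refl zero = refl
≡ᵇ-refl (suc k) = ≡ᵇ-refl k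

≡ᵇ-sym : ∀ m n → (m ≡ᵇ n) ≡ (n ≡ᵇ m)
≡ᵇ-sym zero zero = refl
≡ᵇ-sym zero (suc n) = refl
≡ᵇ-sym (suc m) zero = refl
≡ᵇ-sym (suc m) (suc n) = ≡ᵇ-sym m n

≡ᵇ-true⇒≡ : ∀ {m n} → (m ≡ᵇ n) ≡ true → m ≡ n
≡ᵇ-true⇒≡ {m} {n} eq = ℕₚ.≡ᵇ⇒≡ m n (Equivalence.from 𝔹ₚ.T-≡ eq)

≢⇒≡ᵇ-false : ∀ {m n} → m ≢ n → (m ≡ᵇ n) ≡ false
≢⇒≡ᵇ-false {m} {n} m≢n with m ≡ᵇ n in eq
... | false = refl
... | true = contradiction (≡ᵇ-true⇒≡ eq) m≢n

≤⇒≤ᵇ-true : ∀ {m n} → m ≤ n → (m ≤ᵇ n) ≡ true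
≤⇒≤ᵇ-true m≤n = Equivalence.to 𝔹ₚ.T-≡ (ℕₚ.≤⇒≤ᵇ m≤n)

m+n≡o⇒+m≡+o-+n : ∀ {c} k {t} → c ℕ.+ k ≡ t → + c ≡ + t - + k
m+n≡o⇒+m≡+o-+n {c} k refl = trans (cancel (+ c) (+ k)) (cong (_- + k) (sym (ℤₚ.pos-+ c k)))
  where
  cancel : ∀ i j → i ≡ i + j - j
  cancel = solve-∀

infix 7 _∈ᵇ_

_∈ᵇ_ : ℕ → List ℕ → Bool
y ∈ᵇ [] = false
y ∈ᵇ (j ∷ b) = (y ≡ᵇ j) ∨ (y ∈ᵇ b)

∉⇒∈ᵇ-false : ∀ {y b} → All (y ≢_) b → (y ∈ᵇ b) ≡ false
∉⇒∈ᵇ-false [] = refl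
∉⇒∈ᵇ-false (y≢j ∷ y∉b) rewrite ≢⇒≡ᵇ-false y≢j = ∉⇒∈ᵇ-false y∉b

allB-cong : ∀ {f g : A → Bool} {xs} → All (λ i → f i ≡ g i) xs → allB f xs ≡ allB g xs
allB-cong [] = refl
allB-cong (e ∷ es) = cong₂ _∧_ e (allB-cong es)

allB-∧ : ∀ (f g : A → Bool) xs → allB (λ i → f i ∧ g i) xs ≡ allB f xs ∧ allB g xs
allB-∧ f g [] = refl
allB-∧ f g (x ∷ xs) with f x | g x
... | true  | true  = allB-∧ f g xs
... | true  | false = sym (𝔹ₚ.∧-zeroʳ (allB f xs))
... | false | _     = refl

allB-≢ᵇ : ∀ y b → allB (λ j → not (y ≡ᵇ j)) b ≡ not (y ∈ᵇ b)
allB-≢ᵇ y [] = refl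
allB-≢ᵇ y (j ∷ b) with y ≡ᵇ j
... | true  = refl
... | false = allB-≢ᵇ y b

count-cong : ∀ {f g : A → Bool} {xs} → All (λ i → f i ≡ g i) xs → count f xs ≡ count g xs
count-cong [] = refl
count-cong {f = f} {g} {x ∷ _} (e ∷ es) rewrite e with g x
... | true  = cong suc (count-cong es)
... | false = count-cong es

count-none : ∀ {f : A → Bool} {xs} → All (λ i → f i ≡ false) xs → count f xs ≡ 0
count-none [] = refl
count-none (e ∷ es) rewrite e = count-none es

count-complement : ∀ (f : A → Bool) xs → count (not ∘ f) xs ℕ.+ count f xs ≡ length xs
count-complement f [] = refl
count-complement f (x ∷ xs) with f x
... | true  = trans (ℕₚ.+-suc _ _) (cong suc (count-complement f xs))
... | false = cong suc (count-complement f xs)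

count-split : ∀ (f g : A → Bool) xs →
  count (λ i → not (f i) ∧ g i) xs ℕ.+ count (λ i → f i ∧ g i) xs ≡ count g xs
count-split f g [] = refl
count-split f g (x ∷ xs) with f x | g x
... | true  | true  = trans (ℕₚ.+-suc _ _) (cong suc (count-split f g xs))
... | true  | false = count-split f g xs
... | false | true  = cong suc (count-split f g xs)
... | false | false = count-split f g xs

count-neither : ∀ (f g : A → Bool) xs →
  count (λ i → not (f i) ∧ not (g i)) xs ℕ.+ (count f xs ℕ.+ count g xs)
    ≡ length xs ℕ.+ count (λ i → f i ∧ g i) xs
count-neither f g [] = refl
count-neither f g (x ∷ xs) with f x | g x | count-neither f g xs
... | true  | true  | ih = trans (+-suc₂ _ _ _) (trans (cong (suc ∘ suc) ih) (sym (cong suc (ℕₚ.+-suc _ _))))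
  where
  +-suc₂ : ∀ a b c → a ℕ.+ (suc b ℕ.+ suc c) ≡ suc (suc (a ℕ.+ (b ℕ.+ c)))
  +-suc₂ a b c = trans (ℕₚ.+-suc a _) (cong suc (trans (cong (a ℕ.+_) (ℕₚ.+-suc b c)) (ℕₚ.+-suc a _)))
... | true  | false | ih = trans (ℕₚ.+-suc _ _) (cong suc ih)
... | false | true  | ih =
  trans (cong (count (λ i → not (f i) ∧ not (g i)) xs ℕ.+_) (ℕₚ.+-suc (count f xs) (count g xs)))
        (trans (ℕₚ.+-suc _ _) (cong suc ih))
... | false | false | ih = cong suc ih

count-≡ᵇ-∉ : ∀ {y xs} → All (y ≢_) xs → count (y ≡ᵇ_) xs ≡ 0
count-≡ᵇ-∉ = count-none ∘ All.map ≢⇒≡ᵇ-false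

sumℤ-++ : ∀ (xs ys : List ℤ) → sumℤ (xs ++ ys) ≡ sumℤ xs + sumℤ ys
sumℤ-++ [] ys = sym (ℤₚ.+-identityˡ _)
sumℤ-++ (x ∷ xs) ys = trans (cong (_+_ x) (sumℤ-++ xs ys)) (sym (ℤₚ.+-assoc x _ _))

sumℤ-concatMap : ∀ {B : Set} (f : B → ℤ) (g : A → List B) xs →
  sumℤ (map f (concatMap g xs)) ≡ sumℤ (map (λ i → sumℤ (map f (g i))) xs)
sumℤ-concatMap f g [] = refl
sumℤ-concatMap f g (x ∷ xs) =
  trans (cong sumℤ (Listₚ.map-++ f (g x) _))
        (trans (sumℤ-++ (map f (g x)) _) (cong (_+_ (sumℤ (map f (g x)))) (sumℤ-concatMap f g xs)))

sumℤ-cong : ∀ {f g : A → ℤ} {xs} → All (λ i → f i ≡ g i) xs → sumℤ (map f xs) ≡ sumℤ (map g xs)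
sumℤ-cong [] = refl
sumℤ-cong (e ∷ es) = cong₂ _+_ e (sumℤ-cong es)

sumℤ-+ : ∀ (f g : A → ℤ) xs → sumℤ (map (λ i → f i + g i) xs) ≡ sumℤ (map f xs) + sumℤ (map g xs)
sumℤ-+ f g [] = refl
sumℤ-+ f g (x ∷ xs) = trans (cong (_+_ (f x + g x)) (sumℤ-+ f g xs)) (interchange (f x) (g x) _ _)
  where
  interchange : ∀ a b c d → (a + b) + (c + d) ≡ (a + c) + (b + d)
  interchange = solve-∀

sumℤ-* : ∀ k (f : A → ℤ) xs → sumℤ (map (λ i → k * f i) xs) ≡ k * sumℤ (map f xs)
sumℤ-* k f [] = sym (ℤₚ.*-zeroʳ k)
sumℤ-* k f (x ∷ xs) = trans (cong (_+_ (k * f x)) (sumℤ-* k f xs)) (sym (ℤₚ.*-distribˡ-+ k (f x) _))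

sumℤ-neg : ∀ (f : A → ℤ) xs → sumℤ (map (λ i → - f i) xs) ≡ - sumℤ (map f xs)
sumℤ-neg f [] = refl
sumℤ-neg f (x ∷ xs) = trans (cong (_+_ (- f x)) (sumℤ-neg f xs)) (sym (ℤₚ.neg-distrib-+ (f x) _))

sumℤ-zero : ∀ (xs : List A) → sumℤ (map (λ _ → + 0) xs) ≡ + 0
sumℤ-zero [] = refl
sumℤ-zero (x ∷ xs) = trans (ℤₚ.+-identityˡ _) (sumℤ-zero xs)

sumℤ-*-zero : ∀ (f : A → ℤ) xs → sumℤ (map (λ i → f i * + 0) xs) ≡ + 0
sumℤ-*-zero f xs = trans (sumℤ-cong (All.universal (λ i → ℤₚ.*-zeroʳ (f i)) xs)) (sumℤ-zero xs)

sumℤ-if : ∀ b (f : A → ℤ) xs →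
  sumℤ (map (λ i → if b then f i else + 0) xs) ≡ (if b then sumℤ (map f xs) else + 0)
sumℤ-if true f xs = refl
sumℤ-if false f xs = sumℤ-zero xs

δ : ℕ → ℕ → ℤ
δ s t = if t ≡ᵇ s then + 1 else + 0

sumℤ-δ : ∀ (c : ℕ → ℤ) t ks → sumℤ (map (λ k → c k * δ k t) ks) ≡ + count (t ≡ᵇ_) ks * c t
sumℤ-δ c t [] = refl
sumℤ-δ c t (k ∷ ks) with t ≡ᵇ k in t≡k
... | true = trans (cong₂ _+_ c-k≡c-t (sumℤ-δ c t ks)) (one-more (c t) (+ count (t ≡ᵇ_) ks))
  where
  c-k≡c-t : c k * + 1 ≡ c t
  c-k≡c-t = trans (ℤₚ.*-identityʳ (c k)) (cong c (sym (≡ᵇ-true⇒≡ t≡k)))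
  one-more : ∀ a m → a + m * a ≡ (+ 1 + m) * a
  one-more = solve-∀
... | false = trans (cong (_+ rest) (ℤₚ.*-zeroʳ (c k))) (trans (ℤₚ.+-identityˡ rest) (sumℤ-δ c t ks))
  where
  rest : ℤ
  rest = sumℤ (map (λ k → c k * δ k t) ks)

interval : ℕ → ℕ → List ℕ
interval a zero = []
interval a (suc l) = a ∷ interval (suc a) l

interval-bounds : ∀ a l → All (λ j → a ≤ j × j < a ℕ.+ l) (interval a l)
interval-bounds a zero = []
interval-bounds a (suc l) =
  (ℕₚ.≤-refl , ℕₚ.m<m+n a (s≤s z≤n))
    ∷ All.map (λ (a<j , j<) → ℕₚ.<⇒≤ a<j , widen j<) (interval-bounds (suc a) l)
  where
  widen : ∀ {j} → j < suc a ℕ.+ l → j < a ℕ.+ suc l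
  widen j< = ℕₚ.≤-trans j< (ℕₚ.≤-reflexive (sym (ℕₚ.+-suc a l)))

interval-unique : ∀ a l → Unique (interval a l)
interval-unique a zero = []
interval-unique a (suc l) =
  All.map (λ (a<j , _) → ℕₚ.<⇒≢ a<j) (interval-bounds (suc a) l) ∷ interval-unique (suc a) l

count-≡ᵇ-interval : ∀ {a l y} → a ≤ y → y < a ℕ.+ l → count (y ≡ᵇ_) (interval a l) ≡ 1
count-≡ᵇ-interval {a} {zero} a≤y y< =
  contradiction (ℕₚ.≤-trans y< (ℕₚ.≤-reflexive (ℕₚ.+-identityʳ a))) (ℕₚ.≤⇒≯ a≤y)
count-≡ᵇ-interval {a} {suc l} {y} a≤y y< with ℕₚ.m≤n⇒m<n∨m≡n a≤y
... | inj₂ refl rewrite ≡ᵇ-refl a =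
  cong suc (count-≡ᵇ-∉ (All.map (λ (a<j , _) → ℕₚ.<⇒≢ a<j) (interval-bounds (suc a) l)))
... | inj₁ a<y rewrite ≢⇒≡ᵇ-false (ℕₚ.>⇒≢ a<y) =
  count-≡ᵇ-interval a<y (ℕₚ.≤-trans y< (ℕₚ.≤-reflexive (ℕₚ.+-suc a l)))

length-interval : ∀ a l → length (interval a l) ≡ l
length-interval a zero = refl
length-interval a (suc l) = cong suc (length-interval (suc a) l)

applyUpTo-interval : ∀ (f : ℕ → ℕ) a l → (∀ i → f i ≡ a ℕ.+ i) → applyUpTo f l ≡ interval a l
applyUpTo-interval f a zero f≗ = refl
applyUpTo-interval f a (suc l) f≗ =
  cong₂ _∷_ (trans (f≗ 0) (ℕₚ.+-identityʳ a))
    (applyUpTo-interval (f ∘ suc) (suc a) l (λ i → trans (f≗ (suc i)) (ℕₚ.+-suc a i)))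

upTo-interval : ∀ l → upTo l ≡ interval 0 l
upTo-interval l = applyUpTo-interval id 0 l (λ _ → refl)

map-suc-interval : ∀ a l → map suc (interval a l) ≡ interval (suc a) l
map-suc-interval a zero = refl
map-suc-interval a (suc l) = cong (suc a ∷_) (map-suc-interval (suc a) l)

vertexList-interval : ∀ n → vertexList n ≡ interval 1 n
vertexList-interval n = trans (cong (map suc) (upTo-interval n)) (map-suc-interval 0 n)

-- Set partitions

Partition : Set → Set
Partition A = List (List A)

module _ {A : Set} where

  All-setPartitions-∷ : ∀ {P Q : Partition A → Set} x xs →
    (∀ {p} → P p → Q ([ x ] ∷ p)) → (∀ {p} → P p → All Q (insertEverywhere x p)) →
    All P (setPartitions xs) → All Q (setPartitions (x ∷ xs))
  All-setPartitions-∷ x xs single insert ps =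
    Allₚ.concat⁺ (Allₚ.map⁺ (All.map (λ p → single p ∷ insert p) ps))

  insertEverywhere-length : ∀ x (p : Partition A) → All (λ q → length q ≡ length p) (insertEverywhere x p)
  insertEverywhere-length x [] = []
  insertEverywhere-length x (b ∷ bs) =
    refl ∷ Allₚ.map⁺ (All.map (cong suc) (insertEverywhere-length x bs))

  insertEverywhere-All : ∀ {Q : List A → Set} {x p} →
    (∀ {b} → Q b → Q (x ∷ b)) → All Q p → All (All Q) (insertEverywhere x p)
  insertEverywhere-All grow [] = []
  insertEverywhere-All grow (qb ∷ qbs) =
    (grow qb ∷ qbs) ∷ Allₚ.map⁺ (All.map (qb ∷_) (insertEverywhere-All grow qbs))

  insertEverywhere-count : ∀ {f : List A → Bool} {x} → (∀ b → f (x ∷ b) ≡ f b) →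
    ∀ p → All (λ q → count f q ≡ count f p) (insertEverywhere x p)
  insertEverywhere-count f-x∷ [] = []
  insertEverywhere-count {f} f-x∷ (b ∷ bs) =
    cong (λ v → if v then suc (count f bs) else count f bs) (f-x∷ b)
      ∷ Allₚ.map⁺ (All.map (cong (λ c → if f b then suc c else c)) (insertEverywhere-count f-x∷ bs))

  insertEverywhere-count-new : ∀ {f : List A → Bool} {x} → (∀ b → f (x ∷ b) ≡ true) →
    ∀ {p} → All (λ b → f b ≡ false) p → All (λ q → count f q ≡ 1) (insertEverywhere x p)
  insertEverywhere-count-new f-x∷ [] = []
  insertEverywhere-count-new {f} f-x∷ {b ∷ bs} (fb ∷ fbs) =
    trans (cong (λ v → if v then suc (count f bs) else count f bs) (f-x∷ b)) (cong suc (count-none fbs))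
      ∷ Allₚ.map⁺ (All.map (λ {q} e → trans (cong (λ v → if v then suc (count f q) else count f q) fb) e)
                           (insertEverywhere-count-new f-x∷ fbs))

  length-setPartitions : ∀ xs → All (λ p → length p ≤ length xs) (setPartitions xs)
  length-setPartitions [] = z≤n ∷ []
  length-setPartitions (x ∷ xs) = All-setPartitions-∷ x xs s≤s inserted (length-setPartitions xs)
    where
    inserted : ∀ {p} → length p ≤ length xs → All (λ q → length q ≤ suc (length xs)) (insertEverywhere x p)
    inserted {p} |p|≤ =
      All.map (λ e → ℕₚ.m≤n⇒m≤1+n (ℕₚ.≤-trans (ℕₚ.≤-reflexive e) |p|≤)) (insertEverywhere-length x p)

  length-setPartitions-∷ : ∀ x xs → All (λ p → 1 ≤ length p) (setPartitions (x ∷ xs))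
  length-setPartitions-∷ x xs = All-setPartitions-∷ x xs (λ _ → s≤s z≤n) (λ {p} _ → inserted p)
    (All.universal (λ _ → tt) (setPartitions xs))
    where
    inserted : ∀ p → All (λ q → 1 ≤ length q) (insertEverywhere x p)
    inserted [] = []
    inserted (b ∷ bs) =
      All.map (λ e → ℕₚ.≤-trans (s≤s z≤n) (ℕₚ.≤-reflexive (sym e))) (insertEverywhere-length x (b ∷ bs))

  All-setPartitions : ∀ {P : A → Set} {xs} → All P xs → All (All (All P)) (setPartitions xs)
  All-setPartitions [] = [] ∷ []
  All-setPartitions {xs = x ∷ xs} (px ∷ pxs) =
    All-setPartitions-∷ x xs ((px ∷ []) ∷_) (insertEverywhere-All (px ∷_)) (All-setPartitions pxs)

  setPartitions-nonempty : ∀ xs → All (All (_≢ [])) (setPartitions xs)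
  setPartitions-nonempty [] = [] ∷ []
  setPartitions-nonempty (x ∷ xs) =
    All-setPartitions-∷ x xs ((λ ()) ∷_) (insertEverywhere-All (λ _ ())) (setPartitions-nonempty xs)

count-∈ᵇ-setPartitions : ∀ y {xs} → Unique xs →
  All (λ p → count (y ∈ᵇ_) p ≡ count (y ≡ᵇ_) xs) (setPartitions xs)
count-∈ᵇ-setPartitions y [] = refl ∷ []
count-∈ᵇ-setPartitions y {x ∷ xs} (x∉xs ∷ u) =
  All-setPartitions-∷ x xs single insert (All.zip (count-∈ᵇ-setPartitions y u , All-setPartitions x∉xs))
  where
  single : ∀ {p} → count (y ∈ᵇ_) p ≡ count (y ≡ᵇ_) xs × All (All (x ≢_)) p →
    count (y ∈ᵇ_) ([ x ] ∷ p) ≡ count (y ≡ᵇ_) (x ∷ xs)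
  single (c≡ , _) with y ≡ᵇ x
  ... | true  = cong suc c≡
  ... | false = c≡
  insert : ∀ {p} → count (y ∈ᵇ_) p ≡ count (y ≡ᵇ_) xs × All (All (x ≢_)) p →
    All (λ q → count (y ∈ᵇ_) q ≡ count (y ≡ᵇ_) (x ∷ xs)) (insertEverywhere x p)
  insert {p} (c≡ , x∉p) with y ℕ.≟ x
  ... | yes refl rewrite ≡ᵇ-refl y =
    All.map (λ e → trans e (cong suc (sym (count-≡ᵇ-∉ x∉xs))))
      (insertEverywhere-count-new (λ b → cong (_∨ (y ∈ᵇ b)) (≡ᵇ-refl y)) (All.map ∉⇒∈ᵇ-false x∉p))
  ... | no y≢x rewrite ≢⇒≡ᵇ-false y≢x =
    All.map (λ e → trans e c≡) (insertEverywhere-count (λ b → cong (_∨ (y ∈ᵇ b)) (≢⇒≡ᵇ-false y≢x)) p)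

together : ℕ → ℕ → Partition ℕ → ℕ
together y z = count (λ b → y ∈ᵇ b ∧ z ∈ᵇ b)

-- Weighted sums over the partitions into independent blocks

module IndependentPartitionSums {A : Set} (adj : A → A → Bool)
  (adj-sym : ∀ i j → adj i j ≡ adj j i) (adj-irrefl : ∀ i → adj i i ≡ false) where

  compatible : A → List A → Bool
  compatible x b = allB (λ j → not (adj x j)) b

  compatible-false : ∀ {x b} → All (λ j → adj x j ≡ true) b → b ≢ [] → compatible x b ≡ false
  compatible-false (x~j ∷ _) _ rewrite x~j = refl
  compatible-false [] b≢[] = contradiction refl b≢[]

  isIndependent : List A → Bool
  isIndependent b = allB (λ i → compatible i b) b

  isIndependent-∷ : ∀ x b → isIndependent (x ∷ b) ≡ compatible x b ∧ isIndependent b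
  isIndependent-∷ x b = begin
    (not (adj x x) ∧ compatible x b) ∧ allB (λ i → not (adj i x) ∧ compatible i b) b
      ≡⟨ cong₂ (λ u v → (not u ∧ compatible x b) ∧ v) (adj-irrefl x) (allB-∧ _ _ b) ⟩
    compatible x b ∧ (allB (λ i → not (adj i x)) b ∧ isIndependent b)
      ≡⟨ cong (λ v → compatible x b ∧ (v ∧ isIndependent b))
              (allB-cong (All.universal (λ i → cong not (adj-sym i x)) b)) ⟩
    compatible x b ∧ (compatible x b ∧ isIndependent b)
      ≡⟨ ∧-absorb (compatible x b) ⟩
    compatible x b ∧ isIndependent b ∎
    where
    open ≡-Reasoning
    ∧-absorb : ∀ u {v} → u ∧ (u ∧ v) ≡ u ∧ v
    ∧-absorb true = refl
    ∧-absorb false = refl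

  onIndependent : (Partition A → ℤ) → Partition A → ℤ
  onIndependent W p = if allB isIndependent p then W p else + 0

  partitionSum : List A → (Partition A → ℤ) → ℤ
  partitionSum xs W = sumℤ (map (onIndependent W) (setPartitions xs))

  insertionSum : A → Partition A → (Partition A → ℤ) → ℤ
  insertionSum x [] W = + 0
  insertionSum x (b ∷ bs) W = (if compatible x b then W ((x ∷ b) ∷ bs) else + 0) + insertionSum x bs (W ∘ (b ∷_))

  onIndependent-∷ : ∀ W b q →
    onIndependent W (b ∷ q) ≡ (if isIndependent b then onIndependent (W ∘ (b ∷_)) q else + 0)
  onIndependent-∷ W b q with isIndependent b
  ... | true  = refl
  ... | false = refl

  sumℤ-insertEverywhere : ∀ x p W →
    sumℤ (map (onIndependent W) (insertEverywhere x p))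
      ≡ (if allB isIndependent p then insertionSum x p W else + 0)
  sumℤ-insertEverywhere x [] W = refl
  sumℤ-insertEverywhere x (b ∷ bs) W = begin
    onIndependent W ((x ∷ b) ∷ bs) + sumℤ (map (onIndependent W) (map (b ∷_) (insertEverywhere x bs)))
      ≡⟨ cong₂ _+_ (cong (λ v → if v ∧ allB isIndependent bs then W ((x ∷ b) ∷ bs) else + 0) (isIndependent-∷ x b))
                   (sym (cong sumℤ (Listₚ.map-∘ (insertEverywhere x bs)))) ⟩
    new-block + sumℤ (map (onIndependent W ∘ (b ∷_)) (insertEverywhere x bs))
      ≡⟨ cong (_+_ new-block) (sumℤ-cong (All.universal (onIndependent-∷ W b) (insertEverywhere x bs))) ⟩
    new-block + sumℤ (map (λ q → if isIndependent b then onIndependent W′ q else + 0) (insertEverywhere x bs))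
      ≡⟨ cong (_+_ new-block) (sumℤ-if (isIndependent b) (onIndependent W′) (insertEverywhere x bs)) ⟩
    new-block + (if isIndependent b then sumℤ (map (onIndependent W′) (insertEverywhere x bs)) else + 0)
      ≡⟨ cong (λ s → new-block + (if isIndependent b then s else + 0)) (sumℤ-insertEverywhere x bs W′) ⟩
    new-block + (if isIndependent b then (if allB isIndependent bs then insertionSum x bs W′ else + 0) else + 0)
      ≡⟨ merge (compatible x b) (isIndependent b) (allB isIndependent bs) ⟩
    (if isIndependent b ∧ allB isIndependent bs then insertionSum x (b ∷ bs) W else + 0) ∎
    where
    open ≡-Reasoning
    W′ : Partition A → ℤ
    W′ = W ∘ (b ∷_)
    new-block : ℤ
    new-block = if (compatible x b ∧ isIndependent b) ∧ allB isIndependent bs then W ((x ∷ b) ∷ bs) else + 0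
    merge : ∀ c i r {u v} → (if (c ∧ i) ∧ r then u else + 0) + (if i then (if r then v else + 0) else + 0)
      ≡ (if i ∧ r then (if c then u else + 0) + v else + 0)
    merge true  true  true  = refl
    merge true  true  false = refl
    merge true  false _     = refl
    merge false true  true  = refl
    merge false true  false = refl
    merge false false _     = refl

  partitionSum-∷ : ∀ x xs W → partitionSum (x ∷ xs) W ≡ partitionSum xs (λ p → W ([ x ] ∷ p) + insertionSum x p W)
  partitionSum-∷ x xs W =
    trans (sumℤ-concatMap (onIndependent W) (λ p → ([ x ] ∷ p) ∷ insertEverywhere x p) (setPartitions xs))
          (sumℤ-cong (All.universal split (setPartitions xs)))
    where
    split : ∀ p → onIndependent W ([ x ] ∷ p) + sumℤ (map (onIndependent W) (insertEverywhere x p))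
      ≡ onIndependent (λ p → W ([ x ] ∷ p) + insertionSum x p W) p
    split p rewrite sumℤ-insertEverywhere x p W | adj-irrefl x with allB isIndependent p
    ... | true  = refl
    ... | false = refl

  partitionSum-[_] : ∀ y W → partitionSum [ y ] W ≡ W [ [ y ] ]
  partitionSum-[ y ] W rewrite adj-irrefl y = ℤₚ.+-identityʳ _

  partitionSum-cong : ∀ xs {W W′ : Partition A → ℤ} → All (λ p → W p ≡ W′ p) (setPartitions xs) →
    partitionSum xs W ≡ partitionSum xs W′
  partitionSum-cong xs eqs = sumℤ-cong (All.map (λ {p} → cong (if allB isIndependent p then_else + 0)) eqs)

  partitionSum-length-cong : ∀ xs → xs ≢ [] → (g h : ℕ → ℤ) → (∀ t → g (suc t) ≡ h (suc t)) →
    partitionSum xs (g ∘ length) ≡ partitionSum xs (h ∘ length)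
  partitionSum-length-cong [] []≢[] g h g≗h = contradiction refl []≢[]
  partitionSum-length-cong (x ∷ xs) _ g h g≗h =
    partitionSum-cong (x ∷ xs) (All.map agree (length-setPartitions-∷ x xs))
    where
    agree : ∀ {t} → 1 ≤ t → g t ≡ h t
    agree {suc t} _ = g≗h t

  partitionSum-+ : ∀ xs W W′ → partitionSum xs (λ p → W p + W′ p) ≡ partitionSum xs W + partitionSum xs W′
  partitionSum-+ xs W W′ =
    trans (sumℤ-cong (All.universal split (setPartitions xs)))
          (sumℤ-+ (onIndependent W) (onIndependent W′) (setPartitions xs))
    where
    split : ∀ p → onIndependent (λ p → W p + W′ p) p ≡ onIndependent W p + onIndependent W′ p
    split p with allB isIndependent p
    ... | true  = refl
    ... | false = refl

  onIndependent-∘ : ∀ (F : ℤ → ℤ) → F (+ 0) ≡ + 0 → ∀ W p → onIndependent (F ∘ W) p ≡ F (onIndependent W p)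
  onIndependent-∘ F F0≡0 W p with allB isIndependent p
  ... | true  = refl
  ... | false = sym F0≡0

  partitionSum-neg : ∀ xs W → partitionSum xs (λ p → - W p) ≡ - partitionSum xs W
  partitionSum-neg xs W =
    trans (sumℤ-cong (All.universal (onIndependent-∘ -_ refl W) (setPartitions xs)))
          (sumℤ-neg (onIndependent W) (setPartitions xs))

  partitionSum-* : ∀ xs k W → partitionSum xs (λ p → k * W p) ≡ k * partitionSum xs W
  partitionSum-* xs k W =
    trans (sumℤ-cong (All.universal (onIndependent-∘ (k *_) (ℤₚ.*-zeroʳ k) W) (setPartitions xs)))
          (sumℤ-* k (onIndependent W) (setPartitions xs))

  partitionSum-zero : ∀ xs → partitionSum xs (λ _ → + 0) ≡ + 0
  partitionSum-zero xs =
    trans (sumℤ-cong (All.universal (onIndependent-∘ (λ _ → + 0) refl (λ _ → + 0)) (setPartitions xs)))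
          (sumℤ-zero (setPartitions xs))

  sumℤ-partitionSum : ∀ {B : Set} xs (W : B → Partition A → ℤ) ks →
    sumℤ (map (λ k → partitionSum xs (W k)) ks) ≡ partitionSum xs (λ p → sumℤ (map (λ k → W k p) ks))
  sumℤ-partitionSum xs W [] = sym (partitionSum-zero xs)
  sumℤ-partitionSum xs W (k ∷ ks) =
    trans (cong (_+_ (partitionSum xs (W k))) (sumℤ-partitionSum xs W ks))
          (sym (partitionSum-+ xs (W k) (λ p → sumℤ (map (λ k → W k p) ks))))

  count-onIndependent : ∀ (f : Partition A → Bool) ps →
    + count (λ p → f p ∧ allB isIndependent p) ps ≡ sumℤ (map (onIndependent (λ p → if f p then + 1 else + 0)) ps)
  count-onIndependent f [] = refl
  count-onIndependent f (p ∷ ps) with f p | allB isIndependent p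
  ... | true  | true  = cong (_+_ (+ 1)) (count-onIndependent f ps)
  ... | true  | false = trans (count-onIndependent f ps) (sym (ℤₚ.+-identityˡ _))
  ... | false | true  = trans (count-onIndependent f ps) (sym (ℤₚ.+-identityˡ _))
  ... | false | false = trans (count-onIndependent f ps) (sym (ℤₚ.+-identityˡ _))

  insertionSum-cong : ∀ x p {W W′ : Partition A → ℤ} → (∀ q → W q ≡ W′ q) →
    insertionSum x p W ≡ insertionSum x p W′
  insertionSum-cong x [] eq = refl
  insertionSum-cong x (b ∷ bs) eq =
    cong₂ _+_ (cong (if compatible x b then_else + 0) (eq _)) (insertionSum-cong x bs (eq ∘ (b ∷_)))

  insertionSum-none : ∀ x {p} W → All (λ b → compatible x b ≡ false) p → insertionSum x p W ≡ + 0
  insertionSum-none x W [] = refl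
  insertionSum-none x {b ∷ _} W (c ∷ cs) rewrite c = trans (ℤₚ.+-identityˡ _) (insertionSum-none x (W ∘ (b ∷_)) cs)

  insertionSum-length : ∀ x p (g : ℕ → ℤ) → insertionSum x p (g ∘ length) ≡ + count (compatible x) p * g (length p)
  insertionSum-length x [] g = refl
  insertionSum-length x (b ∷ bs) g rewrite insertionSum-length x bs (g ∘ suc) with compatible x b
  ... | true  = trans (cong (_+ c * G) (sym (ℤₚ.*-identityˡ G))) (sym (ℤₚ.*-distribʳ-+ G (+ 1) c))
    where
    G c : ℤ
    G = g (suc (length bs))
    c = + count (compatible x) bs
  ... | false = ℤₚ.+-identityˡ _

  insertionSum-count : ∀ {f h : List A → Bool} x (g : ℕ → ℤ) → (∀ b → f (x ∷ b) ≡ h b) →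
    ∀ {p} → All (λ b → f b ≡ false) p →
    insertionSum x p (λ q → + count f q * g (length q)) ≡ + count (λ b → compatible x b ∧ h b) p * g (length p)
  insertionSum-count x g f-x∷ [] = refl
  insertionSum-count {f} {h} x g f-x∷ {b ∷ bs} (fb ∷ fbs) = begin
    (if compatible x b then + count f ((x ∷ b) ∷ bs) * G else + 0)
      + insertionSum x bs (λ q → + count f (b ∷ q) * g (suc (length q)))
      ≡⟨ cong₂ _+_ (cong (λ c → if compatible x b then + c * G else + 0) new)
                   (insertionSum-cong x bs (λ q → cong (λ c → + c * g (suc (length q))) (old q))) ⟩
    (if compatible x b then + (if h b then 1 else 0) * G else + 0)
      + insertionSum x bs (λ q → + count f q * g (suc (length q)))
      ≡⟨ cong (_+_ (if compatible x b then + (if h b then 1 else 0) * G else + 0))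
              (insertionSum-count x (g ∘ suc) f-x∷ fbs) ⟩
    (if compatible x b then + (if h b then 1 else 0) * G else + 0)
      + + count (λ b → compatible x b ∧ h b) bs * G
      ≡⟨ combine (compatible x b) (h b) ⟩
    + count (λ b → compatible x b ∧ h b) (b ∷ bs) * G ∎
    where
    open ≡-Reasoning
    G : ℤ
    G = g (suc (length bs))
    new : count f ((x ∷ b) ∷ bs) ≡ (if h b then 1 else 0)
    new = trans (cong (λ v → if v then suc (count f bs) else count f bs) (f-x∷ b))
                (cong (λ c → if h b then suc c else c) (count-none fbs))
    old : ∀ q → count f (b ∷ q) ≡ count f q
    old q = cong (λ v → if v then suc (count f q) else count f q) fb
    combine : ∀ u v {c} →
      (if u then + (if v then 1 else 0) * G else + 0) + + c * G ≡ + (if u ∧ v then suc c else c) * G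
    combine true  true  {c} = sym (ℤₚ.*-distribʳ-+ G (+ 1) (+ c))
    combine true  false     = ℤₚ.+-identityˡ _
    combine false _         = ℤₚ.+-identityˡ _

-- Shifted signed factorials and the path operator ∂

-- φ r t = (-1)^(t-r) (t-r)! for t ≥ r, and 0 for t < r.
φ : ℕ → ℕ → ℤ
φ zero t = signPow t * + (t !)
φ (suc r) zero = + 0
φ (suc r) (suc t) = φ r t

φ₀-suc : ∀ t → φ 0 (suc t) ≡ - (+ suc t * φ 0 t)
φ₀-suc t = begin
  - signPow t * + (suc t !)         ≡⟨ cong (- signPow t *_) (ℤₚ.pos-* (suc t) (t !)) ⟩
  - signPow t * (+ suc t * + (t !)) ≡⟨ rearrange (signPow t) (+ suc t) (+ (t !)) ⟩
  - (+ suc t * (signPow t * + (t !))) ∎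
  where
  open ≡-Reasoning
  rearrange : ∀ s k f → - s * (k * f) ≡ - (k * (s * f))
  rearrange = solve-∀

∂ : (ℕ → ℤ) → ℕ → ℤ
∂ g t = g (suc t) + (+ t - + 1) * g t

∂-+ : ∀ (f g : ℕ → ℤ) t → ∂ (λ u → f u + g u) t ≡ ∂ f t + ∂ g t
∂-+ f g t = distrib (f (suc t)) (g (suc t)) (f t) (g t) (+ t - + 1)
  where
  distrib : ∀ f₁ g₁ f₀ g₀ c → (f₁ + g₁) + c * (f₀ + g₀) ≡ (f₁ + c * f₀) + (g₁ + c * g₀)
  distrib = solve-∀

∂-φ₁ : ∀ t → ∂ (φ 1) (suc t) ≡ - φ 1 (suc t)
∂-φ₁ t = trans (cong (_+ (+ suc t - + 1) * φ 0 t) (φ₀-suc t)) (cancel (+ suc t) (φ 0 t))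
  where
  cancel : ∀ k f → - (k * f) + (k - + 1) * f ≡ - f
  cancel = solve-∀

∂-φ₂ : ∀ t → ∂ (φ 2) (suc t) ≡ δ 1 (suc t)
∂-φ₂ zero = refl
∂-φ₂ (suc t) = trans (cong (_+ (+ suc (suc t) - + 1) * φ 0 t) (φ₀-suc t)) (cancel (+ suc t) (φ 0 t))
  where
  cancel : ∀ k f → - (k * f) + (+ 1 + k - + 1) * f ≡ + 0
  cancel = solve-∀

∂-δ₁ : ∀ t → ∂ (δ 1) (suc t) ≡ + 0
∂-δ₁ zero = refl
∂-δ₁ (suc t) = trans (ℤₚ.+-identityˡ _) (ℤₚ.*-zeroʳ (+ suc (suc t) - + 1))

H : ℕ → ℤ
H t = φ 1 t + φ 2 t

τ : ℕ → ℤ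
τ zero = + 1
τ (suc l) = (signPow l + δ 1 l) - τ l

τ-closed : ∀ k → τ (suc (suc k)) ≡ signPow (suc k) * + k
τ-closed zero = refl
τ-closed (suc k) rewrite τ-closed k = step (signPow k) (+ k)
  where
  step : ∀ s k → (- - s + + 0) - (- s * k) ≡ - - s * (+ 1 + k)
  step = solve-∀

path-sums-total : ∀ m →
  (- signPow (suc m) + δ 0 (suc m)) - (signPow (suc m) + δ 1 (suc m)) + τ (suc m) ≡ signPow m * + suc m
path-sums-total zero = refl
path-sums-total (suc k) rewrite τ-closed k = step (signPow k) (+ k)
  where
  step : ∀ s k → (- - - s + + 0) - (- - s + + 0) + - s * k ≡ - s * (+ 1 + (+ 1 + k))
  step = solve-∀

sumℤ-φ₀-δ : ∀ N t → t < 3 ℕ.+ N → sumℤ (map (λ k → φ 0 k * δ (3 ℕ.+ k) t) (upTo N)) ≡ φ 3 t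
sumℤ-φ₀-δ N 0 _ = sumℤ-*-zero (φ 0) (upTo N)
sumℤ-φ₀-δ N 1 _ = sumℤ-*-zero (φ 0) (upTo N)
sumℤ-φ₀-δ N 2 _ = sumℤ-*-zero (φ 0) (upTo N)
sumℤ-φ₀-δ N (suc (suc (suc t))) (s≤s (s≤s (s≤s t<N))) = begin
  sumℤ (map (λ k → φ 0 k * δ k t) (upTo N)) ≡⟨ sumℤ-δ (φ 0) t (upTo N) ⟩
  + count (t ≡ᵇ_) (upTo N) * φ 0 t          ≡⟨ cong (λ c → + c * φ 0 t) once ⟩
  + 1 * φ 0 t                                ≡⟨ ℤₚ.*-identityˡ (φ 0 t) ⟩
  φ 0 t ∎
  where
  open ≡-Reasoning
  once : count (t ≡ᵇ_) (upTo N) ≡ 1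
  once = trans (cong (count (t ≡ᵇ_)) (upTo-interval N)) (count-≡ᵇ-interval z≤n t<N)

-- The bipyramid graph

bipyramidAdj-sym : ∀ n i j → bipyramidAdj n i j ≡ bipyramidAdj n j i
bipyramidAdj-sym n i j =
  solve 10 (λ ci cj s t i3 jn in′ j3 ai aj →
             ((ci :* (cj :* (s :+ (t :+ ((i3 :* jn) :+ (in′ :* j3)))))) :+ ((ai :* cj) :+ (aj :* ci)))
          := ((cj :* (ci :* (t :+ (s :+ ((j3 :* in′) :+ (jn :* i3)))))) :+ ((aj :* ci) :+ (ai :* cj))))
        refl (isCycleVertex n i) (isCycleVertex n j) (suc i ≡ᵇ j) (suc j ≡ᵇ i)
             (i ≡ᵇ 3) (j ≡ᵇ n) (i ≡ᵇ n) (j ≡ᵇ 3) (isApex i) (isApex j)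
  where open ∨-∧-Solver

≡ᵇ-∧-≡ᵇ-false : ∀ {m n} → m ≢ n → ∀ i → (i ≡ᵇ m) ∧ (i ≡ᵇ n) ≡ false
≡ᵇ-∧-≡ᵇ-false {m} m≢n i with i ≡ᵇ m in i≡m
... | false = refl
... | true = ≢⇒≡ᵇ-false {i} (λ i≡n → m≢n (trans (sym (≡ᵇ-true⇒≡ i≡m)) i≡n))

isApex-∧-isCycleVertex : ∀ n i → isApex i ∧ isCycleVertex n i ≡ false
isApex-∧-isCycleVertex n 0 = refl
isApex-∧-isCycleVertex n 1 = refl
isApex-∧-isCycleVertex n 2 = refl
isApex-∧-isCycleVertex n (suc (suc (suc _))) = refl

bipyramidAdj-irrefl : ∀ {n} → 3 ≢ n → ∀ i → bipyramidAdj n i i ≡ false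
bipyramidAdj-irrefl {n} 3≢n i
  rewrite ≢⇒≡ᵇ-false {suc i} {i} ℕₚ.1+n≢n | ≡ᵇ-∧-≡ᵇ-false 3≢n i
        | 𝔹ₚ.∧-comm (i ≡ᵇ n) (i ≡ᵇ 3) | ≡ᵇ-∧-≡ᵇ-false 3≢n i | isApex-∧-isCycleVertex n i
  = c∧c∧false (isCycleVertex n i)
  where
  c∧c∧false : ∀ c → (c ∧ (c ∧ false)) ∨ false ∨ false ≡ false
  c∧c∧false true = refl
  c∧c∧false false = refl

module Bipyramid (m : ℕ) where

  n : ℕ
  n = 5 ℕ.+ m

  adj : ℕ → ℕ → Bool
  adj = bipyramidAdj n

  open IndependentPartitionSums adj (bipyramidAdj-sym n) (bipyramidAdj-irrefl (λ ()))

  isCycleVertex-true : ∀ {y} → 3 ≤ y → y ≤ n → isCycleVertex n y ≡ true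
  isCycleVertex-true 3≤y y≤n rewrite ≤⇒≤ᵇ-true 3≤y | ≤⇒≤ᵇ-true y≤n = refl

  isApex-false : ∀ {y} → 3 ≤ y → isApex y ≡ false
  isApex-false (s≤s (s≤s (s≤s _))) = refl

  adj-1 : ∀ {y} → 3 ≤ y → y ≤ n → adj 1 y ≡ true
  adj-1 3≤y y≤n rewrite isCycleVertex-true 3≤y y≤n = refl

  adj-2 : ∀ {y} → 3 ≤ y → y ≤ n → adj 2 y ≡ true
  adj-2 3≤y y≤n rewrite isCycleVertex-true 3≤y y≤n = refl

  adj-3 : ∀ {y} → 4 ≤ y → y ≤ n → adj 3 y ≡ (4 ≡ᵇ y) ∨ (n ≡ᵇ y)
  adj-3 {y} 4≤y y≤n
    rewrite isCycleVertex-true (ℕₚ.<⇒≤ 4≤y) y≤n | isApex-false (ℕₚ.<⇒≤ 4≤y)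
          | ≢⇒≡ᵇ-false {suc y} {3} (ℕₚ.>⇒≢ (s≤s (ℕₚ.<⇒≤ 4≤y)))
    = trans (∨-falses (4 ≡ᵇ y) (y ≡ᵇ n)) (cong ((4 ≡ᵇ y) ∨_) (≡ᵇ-sym y n))
    where
    ∨-falses : ∀ u v → (u ∨ false ∨ v ∨ false) ∨ false ≡ u ∨ v
    ∨-falses true  v = refl
    ∨-falses false v = trans (𝔹ₚ.∨-identityʳ _) (𝔹ₚ.∨-identityʳ v)

  adj-path : ∀ {a y} → 4 ≤ a → a < n → a < y → y ≤ n → adj a y ≡ (suc a ≡ᵇ y)
  adj-path {a} {y} 4≤a a<n a<y y≤n
    rewrite isCycleVertex-true (ℕₚ.<⇒≤ 4≤a) (ℕₚ.<⇒≤ a<n)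
          | isCycleVertex-true (ℕₚ.<⇒≤ (ℕₚ.<-≤-trans 4≤a (ℕₚ.<⇒≤ a<y))) y≤n
          | isApex-false (ℕₚ.<⇒≤ 4≤a) | isApex-false (ℕₚ.<⇒≤ (ℕₚ.<-≤-trans 4≤a (ℕₚ.<⇒≤ a<y)))
          | ≢⇒≡ᵇ-false {suc y} {a} (ℕₚ.>⇒≢ (ℕₚ.m<n⇒m<1+n a<y))
          | ≢⇒≡ᵇ-false {a} {3} (ℕₚ.>⇒≢ 4≤a) | ≢⇒≡ᵇ-false {a} {n} (ℕₚ.<⇒≢ a<n)
    = trans (𝔹ₚ.∨-identityʳ _) (𝔹ₚ.∨-identityʳ _)

  compatible-3 : ∀ {b} → All (λ j → 4 ≤ j × j ≤ n) b → compatible 3 b ≡ not (4 ∈ᵇ b) ∧ not (n ∈ᵇ b)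
  compatible-3 {b} bounds = begin
    allB (λ j → not (adj 3 j)) b
      ≡⟨ allB-cong (All.map (λ {j} (4≤j , j≤n) → trans (cong not (adj-3 4≤j j≤n)) (not-∨ (4 ≡ᵇ j) _)) bounds) ⟩
    allB (λ j → not (4 ≡ᵇ j) ∧ not (n ≡ᵇ j)) b
      ≡⟨ allB-∧ _ _ b ⟩
    allB (λ j → not (4 ≡ᵇ j)) b ∧ allB (λ j → not (n ≡ᵇ j)) b
      ≡⟨ cong₂ _∧_ (allB-≢ᵇ 4 b) (allB-≢ᵇ n b) ⟩
    not (4 ∈ᵇ b) ∧ not (n ∈ᵇ b) ∎
    where
    open ≡-Reasoning
    not-∨ : ∀ u v → not (u ∨ v) ≡ not u ∧ not v
    not-∨ true  v = refl
    not-∨ false v = refl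

  compatible-path : ∀ {a b} → 4 ≤ a → a < n → All (λ j → suc a ≤ j × j ≤ n) b → compatible a b ≡ not (suc a ∈ᵇ b)
  compatible-path {a} {b} 4≤a a<n bounds =
    trans (allB-cong (All.map (λ (a<j , j≤n) → cong not (adj-path 4≤a a<n a<j j≤n)) bounds)) (allB-≢ᵇ (suc a) b)

  path-blocks-within : ∀ {a l} → a ℕ.+ l ≡ n →
    All (All (All (λ j → a ≤ j × j ≤ n))) (setPartitions (interval a (suc l)))
  path-blocks-within {a} {l} a+l≡n =
    All-setPartitions (All.map (λ (a≤j , j<) → a≤j , upper j<) (interval-bounds a (suc l)))
    where
    upper : ∀ {j} → j < a ℕ.+ suc l → j ≤ n
    upper j< = ℕₚ.≤-pred (ℕₚ.≤-trans j< (ℕₚ.≤-reflexive (trans (ℕₚ.+-suc a l) (cong suc a+l≡n))))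

  count-∈ᵇ-path : ∀ {a l y} → a ℕ.+ l ≡ n → a ≤ y → y ≤ n →
    All (λ p → count (y ∈ᵇ_) p ≡ 1) (setPartitions (interval a (suc l)))
  count-∈ᵇ-path {a} {l} {y} a+l≡n a≤y y≤n =
    All.map (λ c≡ → trans c≡ (count-≡ᵇ-interval a≤y y<)) (count-∈ᵇ-setPartitions y (interval-unique a (suc l)))
    where
    y< : y < a ℕ.+ suc l
    y< = ℕₚ.≤-trans (s≤s (ℕₚ.≤-trans y≤n (ℕₚ.≤-reflexive (sym a+l≡n)))) (ℕₚ.≤-reflexive (sym (ℕₚ.+-suc a l)))

  count-compatible-path : ∀ {a p} → 4 ≤ a → a < n → All (All (λ j → suc a ≤ j × j ≤ n)) p →
    count (suc a ∈ᵇ_) p ≡ 1 → count (compatible a) p ℕ.+ 1 ≡ length p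
  count-compatible-path {a} {p} 4≤a a<n bounds once = begin
    count (compatible a) p ℕ.+ 1
      ≡⟨ cong₂ ℕ._+_ (count-cong (All.map (compatible-path 4≤a a<n) bounds)) (sym once) ⟩
    count (not ∘ (suc a ∈ᵇ_)) p ℕ.+ count (suc a ∈ᵇ_) p
      ≡⟨ count-complement (suc a ∈ᵇ_) p ⟩
    length p ∎
    where open ≡-Reasoning

  count-compatible-with-n : ∀ {a p} → 4 ≤ a → a < n → All (All (λ j → suc a ≤ j × j ≤ n)) p →
    count (n ∈ᵇ_) p ≡ 1 → count (λ b → compatible a b ∧ n ∈ᵇ b) p ℕ.+ together (suc a) n p ≡ 1
  count-compatible-with-n {a} {p} 4≤a a<n bounds once = begin
    count (λ b → compatible a b ∧ n ∈ᵇ b) p ℕ.+ together (suc a) n p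
      ≡⟨ cong (ℕ._+ together (suc a) n p)
              (count-cong (All.map (λ {b} bb → cong (_∧ n ∈ᵇ b) (compatible-path 4≤a a<n bb)) bounds)) ⟩
    count (λ b → not (suc a ∈ᵇ b) ∧ n ∈ᵇ b) p ℕ.+ together (suc a) n p
      ≡⟨ count-split (suc a ∈ᵇ_) (n ∈ᵇ_) p ⟩
    count (n ∈ᵇ_) p
      ≡⟨ once ⟩
    1 ∎
    where open ≡-Reasoning

  count-compatible-3 : ∀ {p} → All (All (λ j → 4 ≤ j × j ≤ n)) p → count (4 ∈ᵇ_) p ≡ 1 → count (n ∈ᵇ_) p ≡ 1 →
    count (compatible 3) p ℕ.+ 2 ≡ length p ℕ.+ together 4 n p
  count-compatible-3 {p} bounds once₄ onceₙ = begin
    count (compatible 3) p ℕ.+ 2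
      ≡⟨ cong₂ ℕ._+_ (count-cong (All.map compatible-3 bounds)) (sym (cong₂ ℕ._+_ once₄ onceₙ)) ⟩
    count (λ b → not (4 ∈ᵇ b) ∧ not (n ∈ᵇ b)) p ℕ.+ (count (4 ∈ᵇ_) p ℕ.+ count (n ∈ᵇ_) p)
      ≡⟨ count-neither (4 ∈ᵇ_) (n ∈ᵇ_) p ⟩
    length p ℕ.+ together 4 n p ∎
    where open ≡-Reasoning

  partitionSum-path-∂ : ∀ {a l} → 4 ≤ a → suc a ℕ.+ l ≡ n → ∀ g →
    partitionSum (interval a (2 ℕ.+ l)) (g ∘ length) ≡ partitionSum (interval (suc a) (suc l)) (∂ g ∘ length)
  partitionSum-path-∂ {a} {l} 4≤a e g =
    trans (partitionSum-∷ a (interval (suc a) (suc l)) (g ∘ length))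
          (partitionSum-cong (interval (suc a) (suc l))
            (All.zipWith eliminate (path-blocks-within e , count-∈ᵇ-path e ℕₚ.≤-refl a<n)))
    where
    a<n : a < n
    a<n = ℕₚ.≤-trans (ℕₚ.m≤m+n (suc a) l) (ℕₚ.≤-reflexive e)
    eliminate : ∀ {p} → All (All (λ j → suc a ≤ j × j ≤ n)) p × count (suc a ∈ᵇ_) p ≡ 1 →
      g (suc (length p)) + insertionSum a p (g ∘ length) ≡ ∂ g (length p)
    eliminate {p} (bounds , once) =
      cong (_+_ (g (suc (length p))))
        (trans (insertionSum-length a p g)
               (cong (_* g (length p)) (m+n≡o⇒+m≡+o-+n 1 (count-compatible-path 4≤a a<n bounds once))))

  partitionSum-path-together : ∀ {a l} → 4 ≤ a → suc a ℕ.+ l ≡ n → ∀ g →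
    partitionSum (interval a (2 ℕ.+ l)) (λ p → + together a n p * g (length p))
      ≡ partitionSum (interval (suc a) (suc l)) (g ∘ length)
        - partitionSum (interval (suc a) (suc l)) (λ p → + together (suc a) n p * g (length p))
  partitionSum-path-together {a} {l} 4≤a e g = begin
    partitionSum (a ∷ rest) (T a)
      ≡⟨ partitionSum-∷ a rest (T a) ⟩
    partitionSum rest (λ p → T a ([ a ] ∷ p) + insertionSum a p (T a))
      ≡⟨ partitionSum-cong rest (All.zipWith eliminate (path-blocks-within e , count-∈ᵇ-path e a<n ℕₚ.≤-refl)) ⟩
    partitionSum rest (λ p → g (length p) + - T (suc a) p)
      ≡⟨ partitionSum-+ rest (g ∘ length) (λ p → - T (suc a) p) ⟩
    partitionSum rest (g ∘ length) + partitionSum rest (λ p → - T (suc a) p)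
      ≡⟨ cong (_+_ (partitionSum rest (g ∘ length))) (partitionSum-neg rest (T (suc a))) ⟩
    partitionSum rest (g ∘ length) - partitionSum rest (T (suc a)) ∎
    where
    open ≡-Reasoning
    rest : List ℕ
    rest = interval (suc a) (suc l)
    T : ℕ → Partition ℕ → ℤ
    T y p = + together y n p * g (length p)
    a<n : a < n
    a<n = ℕₚ.≤-trans (ℕₚ.m≤m+n (suc a) l) (ℕₚ.≤-reflexive e)
    n≢a : n ≢ a
    n≢a = ℕₚ.>⇒≢ a<n
    eliminate : ∀ {p} → All (All (λ j → suc a ≤ j × j ≤ n)) p × count (n ∈ᵇ_) p ≡ 1 →
      T a ([ a ] ∷ p) + insertionSum a p (T a) ≡ g (length p) + - T (suc a) p
    eliminate {p} (bounds , once) = begin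
      T a ([ a ] ∷ p) + insertionSum a p (T a)
        ≡⟨ cong₂ _+_ (cong (λ c → + c * g (suc (length p))) singleton-apart) (insertionSum-count a g join n∉p) ⟩
      + 0 + + count (λ b → compatible a b ∧ n ∈ᵇ b) p * g (length p)
        ≡⟨ cong (λ c → + 0 + c * g (length p))
                (m+n≡o⇒+m≡+o-+n (together (suc a) n p) (count-compatible-with-n 4≤a a<n bounds once)) ⟩
      + 0 + (+ 1 - + together (suc a) n p) * g (length p)
        ≡⟨ rearrange (+ together (suc a) n p) (g (length p)) ⟩
      g (length p) + - T (suc a) p ∎
      where
      n∉p : All (λ b → a ∈ᵇ b ∧ n ∈ᵇ b ≡ false) p
      n∉p = All.map (λ {b} bb → cong (_∧ n ∈ᵇ b) (∉⇒∈ᵇ-false (All.map (λ (a<j , _) → ℕₚ.<⇒≢ a<j) bb))) bounds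
      singleton-apart : together a n ([ a ] ∷ p) ≡ 0
      singleton-apart rewrite ≡ᵇ-refl a | ≢⇒≡ᵇ-false n≢a = count-none n∉p
      join : ∀ b → a ∈ᵇ (a ∷ b) ∧ n ∈ᵇ (a ∷ b) ≡ n ∈ᵇ b
      join b rewrite ≡ᵇ-refl a | ≢⇒≡ᵇ-false n≢a = refl
      rearrange : ∀ t x → + 0 + (+ 1 - t) * x ≡ x + - (t * x)
      rearrange = solve-∀

  cycle : List ℕ
  cycle = interval 3 (3 ℕ.+ m)

  path : List ℕ
  path = interval 4 (2 ℕ.+ m)

  apex-incompatible : ∀ {v} → (∀ {y} → 3 ≤ y → y ≤ n → adj v y ≡ true) →
    All (All (λ b → compatible v b ≡ false)) (setPartitions cycle)
  apex-incompatible {v} v~ =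
    All.zipWith (All.zipWith incompatible) (path-blocks-within refl , setPartitions-nonempty cycle)
    where
    incompatible : ∀ {b} → All (λ j → 3 ≤ j × j ≤ n) b × b ≢ [] → compatible v b ≡ false
    incompatible (bounds , b≢[]) = compatible-false {v} (All.map (λ (3≤j , j≤n) → v~ 3≤j j≤n) bounds) b≢[]

  partitionSum-apices : ∀ g →
    partitionSum (1 ∷ 2 ∷ cycle) (g ∘ length) ≡ partitionSum cycle (λ p → g (2 ℕ.+ length p) + g (1 ℕ.+ length p))
  partitionSum-apices g = begin
    partitionSum (1 ∷ 2 ∷ cycle) (g ∘ length)
      ≡⟨ partitionSum-∷ 1 (2 ∷ cycle) (g ∘ length) ⟩
    partitionSum (2 ∷ cycle) (λ p → g (suc (length p)) + insertionSum 1 p (g ∘ length))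
      ≡⟨ partitionSum-cong (2 ∷ cycle)
           (All.universal (λ p → cong (_+_ (g (suc (length p)))) (insertionSum-length 1 p g)) _) ⟩
    partitionSum (2 ∷ cycle) W₁
      ≡⟨ partitionSum-∷ 2 cycle W₁ ⟩
    partitionSum cycle (λ p → W₁ ([ 2 ] ∷ p) + insertionSum 2 p W₁)
      ≡⟨ partitionSum-cong cycle
           (All.zipWith eliminate (apex-incompatible {1} adj-1 , apex-incompatible {2} adj-2)) ⟩
    partitionSum cycle (λ p → g (2 ℕ.+ length p) + g (1 ℕ.+ length p)) ∎
    where
    open ≡-Reasoning
    W₁ : Partition ℕ → ℤ
    W₁ p = g (suc (length p)) + + count (compatible 1) p * g (length p)
    eliminate : ∀ {p} → All (λ b → compatible 1 b ≡ false) p × All (λ b → compatible 2 b ≡ false) p →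
      W₁ ([ 2 ] ∷ p) + insertionSum 2 p W₁ ≡ g (2 ℕ.+ length p) + g (1 ℕ.+ length p)
    eliminate {p} (1-apart , 2-apart) rewrite count-none 1-apart | insertionSum-none 2 W₁ 2-apart =
      trans (ℤₚ.+-identityʳ _) (cong (_+_ (g (2 ℕ.+ length p))) (ℤₚ.*-identityˡ (g (1 ℕ.+ length p))))

  partitionSum-3∷path : ∀ g → partitionSum (3 ∷ path) (g ∘ length)
    ≡ partitionSum path (λ p → (∂ g (length p) - g (length p)) + + together 4 n p * g (length p))
  partitionSum-3∷path g =
    trans (partitionSum-∷ 3 path (g ∘ length))
          (partitionSum-cong path (All.zipWith eliminate
            (path-blocks-within refl
              , All.zip (count-∈ᵇ-path refl ℕₚ.≤-refl 4≤n , count-∈ᵇ-path refl 4≤n ℕₚ.≤-refl))))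
    where
    4≤n : 4 ≤ n
    4≤n = ℕₚ.m≤m+n 4 (suc m)
    eliminate : ∀ {p} → All (All (λ j → 4 ≤ j × j ≤ n)) p × (count (4 ∈ᵇ_) p ≡ 1 × count (n ∈ᵇ_) p ≡ 1) →
      g (suc (length p)) + insertionSum 3 p (g ∘ length)
        ≡ (∂ g (length p) - g (length p)) + + together 4 n p * g (length p)
    eliminate {p} (bounds , once₄ , onceₙ) = begin
      g (suc t) + insertionSum 3 p (g ∘ length)
        ≡⟨ cong (_+_ (g (suc t))) (insertionSum-length 3 p g) ⟩
      g (suc t) + + count (compatible 3) p * g t
        ≡⟨ cong (λ c → g (suc t) + c * g t) (m+n≡o⇒+m≡+o-+n 2 (count-compatible-3 bounds once₄ onceₙ)) ⟩
      g (suc t) + (+ (t ℕ.+ s) - + 2) * g t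
        ≡⟨ cong (λ c → g (suc t) + (c - + 2) * g t) (ℤₚ.pos-+ t s) ⟩
      g (suc t) + (+ t + + s - + 2) * g t
        ≡⟨ rearrange (g (suc t)) (g t) (+ t) (+ s) ⟩
      (∂ g t - g t) + + s * g t ∎
      where
      open ≡-Reasoning
      t s : ℕ
      t = length p
      s = together 4 n p
      rearrange : ∀ g₁ g₀ t s → g₁ + (t + s - + 2) * g₀ ≡ ((g₁ + (t - + 1) * g₀) - g₀) + s * g₀
      rearrange = solve-∀

  private
    advance : ∀ {a l} → a ℕ.+ suc l ≡ n → suc a ℕ.+ l ≡ n
    advance {a} {l} e = trans (sym (ℕₚ.+-suc a l)) e

  partitionSum-φ₁ : ∀ {a l} → 4 ≤ a → a ℕ.+ l ≡ n → partitionSum (interval a (suc l)) (φ 1 ∘ length) ≡ signPow l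
  partitionSum-φ₁ {a} {zero} _ _ = partitionSum-[ a ] (φ 1 ∘ length)
  partitionSum-φ₁ {a} {suc l} 4≤a e = begin
    partitionSum (interval a (2 ℕ.+ l)) (φ 1 ∘ length)
      ≡⟨ partitionSum-path-∂ 4≤a (advance e) (φ 1) ⟩
    partitionSum rest (∂ (φ 1) ∘ length)
      ≡⟨ partitionSum-length-cong rest (λ ()) (∂ (φ 1)) (-_ ∘ φ 1) ∂-φ₁ ⟩
    partitionSum rest (λ p → - φ 1 (length p))
      ≡⟨ partitionSum-neg rest (φ 1 ∘ length) ⟩
    - partitionSum rest (φ 1 ∘ length)
      ≡⟨ cong -_ (partitionSum-φ₁ (ℕₚ.m≤n⇒m≤1+n 4≤a) (advance e)) ⟩
    - signPow l ∎
    where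
    open ≡-Reasoning
    rest : List ℕ
    rest = interval (suc a) (suc l)

  partitionSum-δ₁ : ∀ {a l} → 4 ≤ a → a ℕ.+ l ≡ n → partitionSum (interval a (suc l)) (δ 1 ∘ length) ≡ δ 0 l
  partitionSum-δ₁ {a} {zero} _ _ = partitionSum-[ a ] (δ 1 ∘ length)
  partitionSum-δ₁ {a} {suc l} 4≤a e = begin
    partitionSum (interval a (2 ℕ.+ l)) (δ 1 ∘ length)
      ≡⟨ partitionSum-path-∂ 4≤a (advance e) (δ 1) ⟩
    partitionSum rest (∂ (δ 1) ∘ length)
      ≡⟨ partitionSum-length-cong rest (λ ()) (∂ (δ 1)) (λ _ → + 0) ∂-δ₁ ⟩
    partitionSum rest (λ _ → + 0)
      ≡⟨ partitionSum-zero rest ⟩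
    + 0 ∎
    where
    open ≡-Reasoning
    rest : List ℕ
    rest = interval (suc a) (suc l)

  partitionSum-φ₂ : ∀ {a l} → 4 ≤ a → a ℕ.+ l ≡ n → partitionSum (interval a (suc l)) (φ 2 ∘ length) ≡ δ 1 l
  partitionSum-φ₂ {a} {zero} _ _ = partitionSum-[ a ] (φ 2 ∘ length)
  partitionSum-φ₂ {a} {suc l} 4≤a e = begin
    partitionSum (interval a (2 ℕ.+ l)) (φ 2 ∘ length)
      ≡⟨ partitionSum-path-∂ 4≤a (advance e) (φ 2) ⟩
    partitionSum rest (∂ (φ 2) ∘ length)
      ≡⟨ partitionSum-length-cong rest (λ ()) (∂ (φ 2)) (δ 1) ∂-φ₂ ⟩
    partitionSum rest (δ 1 ∘ length)
      ≡⟨ partitionSum-δ₁ (ℕₚ.m≤n⇒m≤1+n 4≤a) (advance e) ⟩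
    δ 0 l ∎
    where
    open ≡-Reasoning
    rest : List ℕ
    rest = interval (suc a) (suc l)

  partitionSum-H : ∀ {a l} → 4 ≤ a → a ℕ.+ l ≡ n →
    partitionSum (interval a (suc l)) (H ∘ length) ≡ signPow l + δ 1 l
  partitionSum-H {a} {l} 4≤a e =
    trans (partitionSum-+ (interval a (suc l)) (φ 1 ∘ length) (φ 2 ∘ length))
          (cong₂ _+_ (partitionSum-φ₁ 4≤a e) (partitionSum-φ₂ 4≤a e))

  partitionSum-together-H : ∀ {a l} → 4 ≤ a → a ℕ.+ l ≡ n →
    partitionSum (interval a (suc l)) (λ p → + together a n p * H (length p)) ≡ τ l
  partitionSum-together-H {a} {zero} _ e rewrite trans (sym (ℕₚ.+-identityʳ a)) e =
    trans (partitionSum-[ n ] (λ p → + together n n p * H (length p)))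
          (cong (λ v → + (if (v ∨ false) ∧ (v ∨ false) then 1 else 0) * H 1) (≡ᵇ-refl n))
  partitionSum-together-H {a} {suc l} 4≤a e =
    trans (partitionSum-path-together 4≤a (advance e) H)
          (cong₂ _-_ (partitionSum-H 4≤suc-a (advance e)) (partitionSum-together-H 4≤suc-a (advance e)))
    where
    4≤suc-a : 4 ≤ suc a
    4≤suc-a = ℕₚ.m≤n⇒m≤1+n 4≤a

  partitionSum-∂H : partitionSum path (∂ H ∘ length) ≡ - signPow (suc m) + δ 0 (suc m)
  partitionSum-∂H = begin
    partitionSum path (∂ H ∘ length)
      ≡⟨ partitionSum-length-cong path (λ ()) (∂ H) (λ t → - φ 1 t + δ 1 t) ∂H-suc ⟩
    partitionSum path (λ p → - φ 1 (length p) + δ 1 (length p))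
      ≡⟨ partitionSum-+ path (λ p → - φ 1 (length p)) (δ 1 ∘ length) ⟩
    partitionSum path (λ p → - φ 1 (length p)) + partitionSum path (δ 1 ∘ length)
      ≡⟨ cong₂ _+_ (trans (partitionSum-neg path (φ 1 ∘ length)) (cong -_ (partitionSum-φ₁ ℕₚ.≤-refl refl)))
                   (partitionSum-δ₁ ℕₚ.≤-refl refl) ⟩
    - signPow (suc m) + δ 0 (suc m) ∎
    where
    open ≡-Reasoning
    ∂H-suc : ∀ t → ∂ H (suc t) ≡ - φ 1 (suc t) + δ 1 (suc t)
    ∂H-suc t = trans (∂-+ (φ 1) (φ 2) (suc t)) (cong₂ _+_ (∂-φ₁ t) (∂-φ₂ t))

  partitionSum-∂H-H : partitionSum path (λ p → ∂ H (length p) - H (length p))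
    ≡ (- signPow (suc m) + δ 0 (suc m)) - (signPow (suc m) + δ 1 (suc m))
  partitionSum-∂H-H =
    trans (partitionSum-+ path (∂ H ∘ length) (λ p → - H (length p)))
          (cong₂ _+_ partitionSum-∂H
                     (trans (partitionSum-neg path (H ∘ length)) (cong -_ (partitionSum-H ℕₚ.≤-refl refl))))

  alternatingSum-as-partitionSum : alternatingSum n ≡ partitionSum (vertexList n) (φ 3 ∘ length)
  alternatingSum-as-partitionSum = begin
    alternatingSum n
      ≡⟨ sumℤ-cong (All.universal term (upTo (n ∸ 2))) ⟩
    sumℤ (map (λ k → partitionSum V (W k)) (upTo (n ∸ 2)))
      ≡⟨ sumℤ-partitionSum V W (upTo (n ∸ 2)) ⟩
    partitionSum V (λ p → sumℤ (map (λ k → W k p) (upTo (n ∸ 2))))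
      ≡⟨ partitionSum-cong V (All.map (λ {p} → inner {p}) (length-setPartitions V)) ⟩
    partitionSum V (φ 3 ∘ length) ∎
    where
    open ≡-Reasoning
    V : List ℕ
    V = vertexList n
    W : ℕ → Partition ℕ → ℤ
    W k p = φ 0 k * δ (3 ℕ.+ k) (length p)
    length-V : length V ≡ n
    length-V = trans (cong length (vertexList-interval n)) (length-interval 1 n)
    -- a partition of [n] has at most n blocks, so the number of blocks minus 3 lies in upTo (n ∸ 2)
    inner : ∀ {p} → length p ≤ length V → sumℤ (map (λ k → W k p) (upTo (n ∸ 2))) ≡ φ 3 (length p)
    inner |p|≤ = sumℤ-φ₀-δ (n ∸ 2) _ (s≤s (ℕₚ.≤-trans |p|≤ (ℕₚ.≤-reflexive length-V)))
    term : ∀ k → signPow k * (+ (k !) * + piG n (3 ℕ.+ k)) ≡ partitionSum V (W k)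
    term k = begin
      signPow k * (+ (k !) * + piG n (3 ℕ.+ k))
        ≡⟨ sym (ℤₚ.*-assoc (signPow k) _ _) ⟩
      φ 0 k * + piG n (3 ℕ.+ k)
        ≡⟨ cong (_*_ (φ 0 k)) (count-onIndependent (λ p → length p ≡ᵇ 3 ℕ.+ k) (setPartitions V)) ⟩
      φ 0 k * partitionSum V (δ (3 ℕ.+ k) ∘ length)
        ≡⟨ sym (partitionSum-* V (φ 0 k) (δ (3 ℕ.+ k) ∘ length)) ⟩
      partitionSum V (W k) ∎

  alternatingSum-bipyramid : alternatingSum n ≡ signPow m * + suc m
  alternatingSum-bipyramid = begin
    alternatingSum n
      ≡⟨ alternatingSum-as-partitionSum ⟩
    partitionSum (vertexList n) (φ 3 ∘ length)
      ≡⟨ cong (λ xs → partitionSum xs (φ 3 ∘ length)) (vertexList-interval n) ⟩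
    partitionSum (1 ∷ 2 ∷ cycle) (φ 3 ∘ length)
      ≡⟨ partitionSum-apices (φ 3) ⟩
    partitionSum (3 ∷ path) (H ∘ length)
      ≡⟨ partitionSum-3∷path H ⟩
    partitionSum path (λ p → (∂ H (length p) - H (length p)) + + together 4 n p * H (length p))
      ≡⟨ partitionSum-+ path (λ p → ∂ H (length p) - H (length p)) _ ⟩
    partitionSum path (λ p → ∂ H (length p) - H (length p))
      + partitionSum path (λ p → + together 4 n p * H (length p))
      ≡⟨ cong₂ _+_ partitionSum-∂H-H (partitionSum-together-H ℕₚ.≤-refl refl) ⟩
    (- signPow (suc m) + δ 0 (suc m)) - (signPow (suc m) + δ 1 (suc m)) + τ (suc m)
      ≡⟨ path-sums-total m ⟩
    signPow m * + suc m ∎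
    where open ≡-Reasoning

∣signPow∣ : ∀ k → ∣ signPow k ∣ ≡ 1
∣signPow∣ zero = refl
∣signPow∣ (suc k) = trans (ℤₚ.∣-i∣≡∣i∣ (signPow k)) (∣signPow∣ k)

corollary8p6 : (n : ℕ) → 5 ≤ n → (μ : ℕ) → μ ≡ ∣ alternatingSum n ∣ → μ ≡ n ∸ 4
corollary8p6 n 5≤n μ refl with ℕₚ.m≤n⇒∃[o]m+o≡n 5≤n
... | m , refl = begin
  ∣ alternatingSum (5 ℕ.+ m) ∣   ≡⟨ cong ∣_∣ (Bipyramid.alternatingSum-bipyramid m) ⟩
  ∣ signPow m * + suc m ∣        ≡⟨ ℤₚ.abs-* (signPow m) (+ suc m) ⟩
  ∣ signPow m ∣ ℕ.* suc m        ≡⟨ cong (ℕ._* suc m) (∣signPow∣ m) ⟩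
  1 ℕ.* suc m                    ≡⟨ ℕₚ.*-identityˡ (suc m) ⟩
  suc m                          ∎
  where open ≡-Reasoning
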